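{- Let $G=(V,E)$ be a finite simple undirected graph with $V=\{1,\dots,n\}$. For $i,j\in V$ let $a_{ij}=1$ if $i=j$ or $d(i,j)=2$, and $a_{ij}=0$ otherwise; and let $c_{ij}=-1$ if $i=j$, $c_{ij}=1$ if $d(i,j)=2$, and $c_{ij}=0$ otherwise. Then the optimal value of the integer program $$\min \sum_{i=1}^n x_i \ \text{ s.t. }\ \sum_{j=1}^n a_{ij}x_j\ge 1,\ \ \sum_{j=1}^n c_{ij}x_j<\deg_{\mathrm{Dist}(G;2)}(i),\ \ x_i\in\{0,1\}\quad(\forall i\in V)$$ equals the 2-step restrained domination number $\gamma_{2sr}(G)$.
   Context: $d(u,v)$ is the distance in $G$. $\mathrm{Dist}(G;2)$ is the graph with vertex set $V$ and edge set $\{uv: d_G(u,v)=2\}$; so $\deg_{\mathrm{Dist}(G;2)}(i)$ is the number of vertices at distance exactly $2$ from $i$ in $G$. A set $S\subseteq V$ is a hop dominating set if for every $u\in V\setminus S$ there is $v\in S$ with $d(u,v)=2$. A hop dominating set $S$ is a 2-step restrained dominating set if for every $u\in V\setminus S$ there exists $v\in V\setminus S$ with $d(u,v)=2$. $\gamma_{2sr}(G)$ is the minimum cardinality of a 2-step restrained dominating set of $G$. -}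

module Defs where

open import Data.Nat as ℕ using (ℕ; zero; suc)
open import Data.Integer as ℤ using (ℤ; +_; -[1+_])
open import Data.Bool using (Bool; true; false; not; _∧_; if_then_else_)
open import Data.Fin using (Fin; zero; suc)
open import Data.Fin.Properties using () renaming (_≟_ to _≟ᶠ_)
open import Data.Fin.Subset using (Subset; _∈_; _∉_; ∣_∣)
open import Data.Product using (Σ; _×_; ∃)
open import Relation.Binary.PropositionalEquality using (_≡_)
open import Relation.Nullary.Decidable using (⌊_⌋)
open import Relation.Nullary using (¬_)

record Graph (n : ℕ) : Set where
  field
    adj   : Fin n → Fin n → Bool
    sym   : ∀ i j → adj i j ≡ adj j i
    irrefl : ∀ i → adj i i ≡ false
open Graph public

∑ℕ : {n : ℕ} → (Fin n → ℕ) → ℕ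
∑ℕ {zero}  f = 0
∑ℕ {suc n} f = f zero ℕ.+ ∑ℕ (λ j → f (suc j))

∑ℤ : {n : ℕ} → (Fin n → ℤ) → ℤ
∑ℤ {zero}  f = + 0
∑ℤ {suc n} f = f zero ℤ.+ ∑ℤ (λ j → f (suc j))

anyFin : {n : ℕ} → (Fin n → Bool) → Bool
anyFin {zero}  f = false
anyFin {suc n} f = if f zero then true else anyFin (λ j → f (suc j))

dist2 : {n : ℕ} → Graph n → Fin n → Fin n → Bool
dist2 G u v = not ⌊ u ≟ᶠ v ⌋ ∧ not (adj G u v) ∧ anyFin (λ w → adj G u w ∧ adj G w v)

Dist2 : {n : ℕ} → Graph n → Fin n → Fin n → Set
Dist2 G u v = dist2 G u v ≡ true

deg2 : {n : ℕ} → Graph n → Fin n → ℕ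
deg2 G i = ∑ℕ (λ j → if dist2 G i j then 1 else 0)

IsHopDominating : {n : ℕ} → Graph n → Subset n → Set
IsHopDominating G S = ∀ u → u ∉ S → ∃ λ v → v ∈ S × Dist2 G u v

Is2StepRestrainedDominating : {n : ℕ} → Graph n → Subset n → Set
Is2StepRestrainedDominating G S =
  IsHopDominating G S × (∀ u → u ∉ S → ∃ λ v → v ∉ S × Dist2 G u v)

IsGamma2sr : {n : ℕ} → Graph n → ℕ → Set
IsGamma2sr G k =
  (∃ λ S → Is2StepRestrainedDominating G S × ∣ S ∣ ≡ k)
  × (∀ S → Is2StepRestrainedDominating G S → k ℕ.≤ ∣ S ∣)

a : {n : ℕ} → Graph n → Fin n → Fin n → ℤ
a G i j = if ⌊ i ≟ᶠ j ⌋ then + 1 else (if dist2 G i j then + 1 else + 0)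

c : {n : ℕ} → Graph n → Fin n → Fin n → ℤ
c G i j = if ⌊ i ≟ᶠ j ⌋ then -[1+ 0 ] else (if dist2 G i j then + 1 else + 0)

IsBinary : {n : ℕ} → (Fin n → ℤ) → Set
IsBinary x = ∀ i → (x i ≡ + 0) Data.Sum.⊎ (x i ≡ + 1)
  where import Data.Sum

Feasible : {n : ℕ} → Graph n → (Fin n → ℤ) → Set
Feasible G x =
  IsBinary x
  × (∀ i → + 1 ℤ.≤ ∑ℤ (λ j → a G i j ℤ.* x j))
  × (∀ i → ∑ℤ (λ j → c G i j ℤ.* x j) ℤ.< + deg2 G i)

IsOptimalValue : {n : ℕ} → Graph n → ℤ → Set
IsOptimalValue G v =
  (∃ λ x → Feasible G x × ∑ℤ x ≡ v)
  × (∀ x → Feasible G x → v ℤ.≤ ∑ℤ x)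

{-# OPTIONS --safe #-}
module Submission where

-- For the 0/1 vector x of a vertex set S, row i of the a-constraints counts the vertices of S
-- in {i} ∪ N₂(i), where N₂(i) is the set of vertices at distance 2 from i, so it is ≥ 1 iff
-- i ∈ S or S hop-dominates i. Row i of the c-constraints equals |N₂(i) ∩ S| − x_i, which is
-- below deg₂(i) = |N₂(i)| iff i ∈ S or some vertex of N₂(i) lies outside S. Hence the feasible
-- points are exactly the 0/1 vectors of 2-step restrained dominating sets, with objective |S|.

open import Defs
open import Data.Nat using (ℕ)
open import Data.Integer using (+_)
open import Data.Product using (Σ; _×_)

open import Data.Nat as ℕ using (zero; suc; z≤n; s≤s; _≤_; _<_)
import Data.Nat.Properties as ℕ
open import Data.Nat.Induction using (<-rec)
open import Data.Integer as ℤ using (ℤ; -[1+_]; +≤+; +<+)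
import Data.Integer.Properties as ℤ
open import Data.Integer.Tactic.RingSolver using (solve-∀)
open import Data.Bool as Bool using (Bool; true; false; not; _∧_; _∨_; if_then_else_)
open import Data.Bool.Properties using (∨-zeroʳ; T-≡)
open import Data.Fin using (Fin; zero; suc; toℕ; fromℕ<)
open import Data.Fin.Properties using (any?; all?; toℕ<n; toℕ-fromℕ<) renaming (_≟_ to _≟ᶠ_)
open import Data.Fin.Subset using (Subset; _∈_; _∉_; ∣_∣; ⊤)
open import Data.Fin.Subset.Properties using (anySubset?; _∈?_; ∈⊤)
open import Data.Vec using ([]; _∷_; lookup; tabulate)
open import Data.Vec.Properties using (lookup∘tabulate; []=⇒lookup; lookup⇒[]=)
open import Data.Product using (_,_; proj₁; ∃-syntax)
open import Data.Sum using (_⊎_; inj₁; inj₂)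
open import Function using (_⇔_; mk⇔; Equivalence)
open import Relation.Binary.PropositionalEquality using (_≡_; refl; cong; cong₂; trans; subst; module ≡-Reasoning) renaming (sym to ≡-sym)
open import Relation.Nullary using (Dec; yes; no; contradiction)
open import Relation.Nullary.Decidable using (⌊_⌋; toWitness; fromWitness; _×-dec_; _→-dec_; ¬?)
open import Relation.Unary using (Decidable)

private
  variable
    n : ℕ

least-witness : ∀ {p} {P : ℕ → Set p} → Decidable P →
                ∀ {m} → P m → ∃[ k ] P k × (∀ {j} → P j → k ≤ j)
least-witness {P = P} P? {m} = <-rec (λ m → P m → ∃[ k ] P k × (∀ {j} → P j → k ≤ j)) search m
  where
  search : ∀ m → (∀ {j} → j < m → P j → ∃[ k ] P k × (∀ {i} → P i → k ≤ i)) →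
           P m → ∃[ k ] P k × (∀ {j} → P j → k ≤ j)
  search m rec pm with any? (λ (j : Fin m) → P? (toℕ j))
  ... | yes (j , pj) = rec (toℕ<n j) pj
  ... | no none = m , pm , λ {j} pj → ℕ.≮⇒≥ λ j<m →
        none (fromℕ< j<m , subst P (≡-sym (toℕ-fromℕ< j<m)) pj)

∑ℤ-cong : {f g : Fin n → ℤ} → (∀ j → f j ≡ g j) → ∑ℤ f ≡ ∑ℤ g
∑ℤ-cong {zero}  f≗g = refl
∑ℤ-cong {suc n} f≗g = cong₂ ℤ._+_ (f≗g zero) (∑ℤ-cong (λ j → f≗g (suc j)))

∑ℤ-+ : (f : Fin n → ℕ) → ∑ℤ (λ j → + f j) ≡ + ∑ℕ f
∑ℤ-+ {zero}  f = refl
∑ℤ-+ {suc n} f = cong (λ s → + f zero ℤ.+ s) (∑ℤ-+ (λ j → f (suc j)))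

∑ℤ-- : (f g : Fin n → ℤ) → ∑ℤ (λ j → f j ℤ.- g j) ≡ ∑ℤ f ℤ.- ∑ℤ g
∑ℤ-- {zero}  f g = refl
∑ℤ-- {suc n} f g = begin
  (f zero ℤ.- g zero) ℤ.+ ∑ℤ (λ j → f (suc j) ℤ.- g (suc j))
    ≡⟨ cong (λ s → (f zero ℤ.- g zero) ℤ.+ s) (∑ℤ-- (λ j → f (suc j)) (λ j → g (suc j))) ⟩
  (f zero ℤ.- g zero) ℤ.+ (∑ℤ (λ j → f (suc j)) ℤ.- ∑ℤ (λ j → g (suc j)))
    ≡⟨ interchange (f zero) (g zero) _ _ ⟩
  (f zero ℤ.+ ∑ℤ (λ j → f (suc j))) ℤ.- (g zero ℤ.+ ∑ℤ (λ j → g (suc j))) ∎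
  where
  open ≡-Reasoning
  interchange : ∀ w x y z → (w ℤ.- x) ℤ.+ (y ℤ.- z) ≡ (w ℤ.+ y) ℤ.- (x ℤ.+ z)
  interchange = solve-∀

∑ℤ-0 : ∑ℤ {n} (λ _ → + 0) ≡ + 0
∑ℤ-0 {zero}  = refl
∑ℤ-0 {suc n} = cong (λ s → + 0 ℤ.+ s) (∑ℤ-0 {n})

∑ℤ-δ : (i : Fin n) (f : Fin n → ℤ) → ∑ℤ (λ j → if ⌊ i ≟ᶠ j ⌋ then f j else + 0) ≡ f i
∑ℤ-δ {suc n} zero    f = trans (cong (λ s → f zero ℤ.+ s) (∑ℤ-0 {n})) (ℤ.+-identityʳ (f zero))
∑ℤ-δ {suc n} (suc i) f = begin
  + 0 ℤ.+ ∑ℤ (λ j → if ⌊ suc i ≟ᶠ suc j ⌋ then f (suc j) else + 0)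
    ≡⟨ ℤ.+-identityˡ _ ⟩
  ∑ℤ (λ j → if ⌊ suc i ≟ᶠ suc j ⌋ then f (suc j) else + 0)
    ≡⟨ ∑ℤ-cong (λ j → cong (if_then f (suc j) else + 0) (suc≟suc i j)) ⟩
  ∑ℤ (λ j → if ⌊ i ≟ᶠ j ⌋ then f (suc j) else + 0)
    ≡⟨ ∑ℤ-δ i (λ j → f (suc j)) ⟩
  f (suc i) ∎
  where
  open ≡-Reasoning
  suc≟suc : ∀ {m} (i j : Fin m) → ⌊ suc i ≟ᶠ suc j ⌋ ≡ ⌊ i ≟ᶠ j ⌋
  suc≟suc i j with i ≟ᶠ j
  ... | yes _ = refl
  ... | no  _ = refl

bit : Bool → ℕ
bit b = if b then 1 else 0

bit-mono : {x y : Bool} → (x ≡ true → y ≡ true) → bit x ≤ bit y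
bit-mono {false}         _   = z≤n
bit-mono {true}  {true}  _   = s≤s z≤n
bit-mono {true}  {false} x⇒y with () ← x⇒y refl

∧≡true⇒ : {x y : Bool} → x ∧ y ≡ true → x ≡ true × y ≡ true
∧≡true⇒ {true} y≡true = refl , y≡true

∨≡true⇒ : {x y : Bool} → x ∨ y ≡ true → x ≡ true ⊎ y ≡ true
∨≡true⇒ {true}  _        = inj₁ refl
∨≡true⇒ {false} y≡true   = inj₂ y≡true

count : (Fin n → Bool) → ℕ
count f = ∑ℕ (λ j → bit (f j))

_⊆ᵇ_ : (f g : Fin n → Bool) → Set
f ⊆ᵇ g = ∀ j → f j ≡ true → g j ≡ true

count-pos⇔∃ : (f : Fin n → Bool) → 0 < count f ⇔ (∃[ j ] f j ≡ true)
count-pos⇔∃ f = mk⇔ (to f) (from f)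
  where
  to : ∀ {n} (f : Fin n → Bool) → 0 < count f → ∃[ j ] f j ≡ true
  to {suc n} f pos with f zero in f₀
  ... | true  = zero , f₀
  ... | false with (j , fj) ← to (λ j → f (suc j)) pos = suc j , fj
  from : ∀ {n} (f : Fin n → Bool) → ∃[ j ] f j ≡ true → 0 < count f
  from f (zero  , fj) rewrite fj = s≤s z≤n
  from f (suc j , fj) = ℕ.<-≤-trans (from (λ j → f (suc j)) (j , fj)) (ℕ.m≤n+m _ _)

count-mono : {f g : Fin n → Bool} → f ⊆ᵇ g → count f ≤ count g
count-mono {zero}  f⊆g = z≤n
count-mono {suc n} f⊆g = ℕ.+-mono-≤ (bit-mono (f⊆g zero)) (count-mono (λ j → f⊆g (suc j)))

count-<⇔∃ : {f g : Fin n → Bool} → f ⊆ᵇ g → count f < count g ⇔ (∃[ j ] f j ≡ false × g j ≡ true)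
count-<⇔∃ f⊆g = mk⇔ (to f⊆g) (from f⊆g)
  where
  to : ∀ {n} {f g : Fin n → Bool} → f ⊆ᵇ g → count f < count g → ∃[ j ] f j ≡ false × g j ≡ true
  to {suc n} {f} {g} f⊆g f<g with f zero in f₀ | g zero in g₀
  ... | false | true  = zero , f₀ , g₀
  ... | true  | false with () ← trans (≡-sym g₀) (f⊆g zero f₀)
  ... | true  | true  with (j , fj , gj) ← to (λ j → f⊆g (suc j)) (ℕ.s<s⁻¹ f<g) = suc j , fj , gj
  ... | false | false with (j , fj , gj) ← to (λ j → f⊆g (suc j)) f<g = suc j , fj , gj
  from : ∀ {n} {f g : Fin n → Bool} → f ⊆ᵇ g → ∃[ j ] f j ≡ false × g j ≡ true → count f < count g
  from f⊆g (zero , fj , gj) rewrite fj | gj = s≤s (count-mono (λ j → f⊆g (suc j)))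
  from f⊆g (suc j , fj , gj) =
    ℕ.+-mono-≤-< (bit-mono (f⊆g zero)) (from (λ j → f⊆g (suc j)) (j , fj , gj))

∈⇔lookup : {u : Fin n} {S : Subset n} → u ∈ S ⇔ lookup S u ≡ true
∈⇔lookup {u = u} {S} = mk⇔ []=⇒lookup (lookup⇒[]= u S)

∉⇔lookup : {u : Fin n} {S : Subset n} → u ∉ S ⇔ lookup S u ≡ false
∉⇔lookup {u = u} {S} = mk⇔ to from
  where
  to : u ∉ S → lookup S u ≡ false
  to u∉S with lookup S u in eq
  ... | true  = contradiction (Equivalence.from ∈⇔lookup eq) u∉S
  ... | false = refl
  from : lookup S u ≡ false → u ∉ S
  from eq u∈S with () ← trans (≡-sym eq) (Equivalence.to ∈⇔lookup u∈S)

∣S∣≡count : (S : Subset n) → ∣ S ∣ ≡ count (lookup S)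
∣S∣≡count []          = refl
∣S∣≡count (true  ∷ S) = cong suc (∣S∣≡count S)
∣S∣≡count (false ∷ S) = ∣S∣≡count S

indicator : Subset n → Fin n → ℤ
indicator S j = + bit (lookup S j)

indicator-binary : (S : Subset n) → IsBinary (indicator S)
indicator-binary S j with lookup S j
... | true  = inj₂ refl
... | false = inj₁ refl

∑-indicator : (S : Subset n) → ∑ℤ (indicator S) ≡ + ∣ S ∣
∑-indicator S = trans (∑ℤ-+ (λ j → bit (lookup S j))) (cong +_ (≡-sym (∣S∣≡count S)))

support : (Fin n → ℤ) → Subset n
support x = tabulate (λ j → ⌊ x j ℤ.≟ + 1 ⌋)

binary⇒indicator-support : {x : Fin n → ℤ} → IsBinary x → ∀ j → x j ≡ indicator (support x) j
binary⇒indicator-support {x = x} x-binary j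
  rewrite lookup∘tabulate (λ j → ⌊ x j ℤ.≟ + 1 ⌋) j with x-binary j
... | inj₁ xj≡0 rewrite xj≡0 = refl
... | inj₂ xj≡1 rewrite xj≡1 = refl

module _ {n : ℕ} (G : Graph n) (S : Subset n) (i : Fin n) where

  private
    s : Fin n → Bool
    s = lookup S

    N₂ : Fin n → Bool
    N₂ = dist2 G i

  -- dist2 G i j unfolds to  not ⌊ i ≟ᶠ j ⌋ ∧ r,  so both coefficients are functions of ⌊ i ≟ᶠ j ⌋ and r.
  a*indicator : ∀ j → a G i j ℤ.* indicator S j ≡ + bit ((⌊ i ≟ᶠ j ⌋ ∨ N₂ j) ∧ s j)
  a*indicator j = pointwise ⌊ i ≟ᶠ j ⌋ _ (s j)
    where
    pointwise : ∀ e r b → (if e then + 1 else (if not e ∧ r then + 1 else + 0)) ℤ.* + bit b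
                        ≡ + bit ((e ∨ (not e ∧ r)) ∧ b)
    pointwise true  _     true  = refl
    pointwise true  _     false = refl
    pointwise false true  true  = refl
    pointwise false true  false = refl
    pointwise false false _     = refl

  c*indicator : ∀ j → c G i j ℤ.* indicator S j
                    ≡ + bit (N₂ j ∧ s j) ℤ.- (if ⌊ i ≟ᶠ j ⌋ then indicator S j else + 0)
  c*indicator j = pointwise ⌊ i ≟ᶠ j ⌋ _ (s j)
    where
    pointwise : ∀ e r b → (if e then -[1+ 0 ] else (if not e ∧ r then + 1 else + 0)) ℤ.* + bit b
                        ≡ + bit ((not e ∧ r) ∧ b) ℤ.- (if e then + bit b else + 0)
    pointwise true  _     true  = refl
    pointwise true  _     false = refl
    pointwise false true  true  = refl
    pointwise false true  false = refl
    pointwise false false _     = refl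

  a-row : ∑ℤ (λ j → a G i j ℤ.* indicator S j) ≡ + count (λ j → (⌊ i ≟ᶠ j ⌋ ∨ N₂ j) ∧ s j)
  a-row = trans (∑ℤ-cong a*indicator) (∑ℤ-+ (λ j → bit ((⌊ i ≟ᶠ j ⌋ ∨ N₂ j) ∧ s j)))

  c-row : ∑ℤ (λ j → c G i j ℤ.* indicator S j) ≡ + count (λ j → N₂ j ∧ s j) ℤ.- indicator S i
  c-row = begin
    ∑ℤ (λ j → c G i j ℤ.* indicator S j)
      ≡⟨ ∑ℤ-cong c*indicator ⟩
    ∑ℤ (λ j → + bit (N₂ j ∧ s j) ℤ.- (if ⌊ i ≟ᶠ j ⌋ then indicator S j else + 0))
      ≡⟨ ∑ℤ-- (λ j → + bit (N₂ j ∧ s j)) (λ j → if ⌊ i ≟ᶠ j ⌋ then indicator S j else + 0) ⟩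
    ∑ℤ (λ j → + bit (N₂ j ∧ s j)) ℤ.- ∑ℤ (λ j → if ⌊ i ≟ᶠ j ⌋ then indicator S j else + 0)
      ≡⟨ cong₂ ℤ._-_ (∑ℤ-+ (λ j → bit (N₂ j ∧ s j))) (∑ℤ-δ i (indicator S)) ⟩
    + count (λ j → N₂ j ∧ s j) ℤ.- indicator S i ∎
    where open ≡-Reasoning

  a-constraint⇔hop : + 1 ℤ.≤ ∑ℤ (λ j → a G i j ℤ.* indicator S j)
                   ⇔ (i ∉ S → ∃[ v ] v ∈ S × Dist2 G i v)
  a-constraint⇔hop = mk⇔ to from
    where
    to : + 1 ℤ.≤ ∑ℤ (λ j → a G i j ℤ.* indicator S j) → i ∉ S → ∃[ v ] v ∈ S × Dist2 G i v
    to row i∉S with (j , hj) ← Equivalence.to (count-pos⇔∃ _) (ℤ.drop‿+≤+ (subst (+ 1 ℤ.≤_) a-row row))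
      = dominator j hj
      where
      dominator : ∀ j → (⌊ i ≟ᶠ j ⌋ ∨ N₂ j) ∧ s j ≡ true → ∃[ v ] v ∈ S × Dist2 G i v
      dominator j h with (i≡j∨d , sj) ← ∧≡true⇒ h with ∨≡true⇒ i≡j∨d
      ... | inj₁ i≡j = contradiction (subst (_∈ S) (≡-sym (toWitness (Equivalence.from T-≡ i≡j)))
                                                  (Equivalence.from ∈⇔lookup sj)) i∉S
      ... | inj₂ d   = j , Equivalence.from ∈⇔lookup sj , d
    from : (i ∉ S → ∃[ v ] v ∈ S × Dist2 G i v) → + 1 ℤ.≤ ∑ℤ (λ j → a G i j ℤ.* indicator S j)
    from hop = subst (+ 1 ℤ.≤_) (≡-sym a-row) (+≤+ (Equivalence.from (count-pos⇔∃ _) witness))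
      where
      witness : ∃[ j ] (⌊ i ≟ᶠ j ⌋ ∨ N₂ j) ∧ s j ≡ true
      witness with i ∈? S
      ... | yes i∈S =
        i , trans (cong (λ e → (e ∨ N₂ i) ∧ s i) (Equivalence.to T-≡ (fromWitness {a? = i ≟ᶠ i} refl)))
                  (Equivalence.to ∈⇔lookup i∈S)
      ... | no  i∉S with (v , v∈S , d) ← hop i∉S
        = v , trans (cong (λ e → (⌊ i ≟ᶠ v ⌋ ∨ e) ∧ s v) d)
                    (trans (cong (_∧ s v) (∨-zeroʳ ⌊ i ≟ᶠ v ⌋)) (Equivalence.to ∈⇔lookup v∈S))

  c-row-outside : i ∉ S → ∑ℤ (λ j → c G i j ℤ.* indicator S j) ≡ + count (λ j → N₂ j ∧ s j)
  c-row-outside i∉S = begin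
    ∑ℤ (λ j → c G i j ℤ.* indicator S j)           ≡⟨ c-row ⟩
    + count (λ j → N₂ j ∧ s j) ℤ.- + bit (s i)     ≡⟨ cong (λ b → + count (λ j → N₂ j ∧ s j) ℤ.- + bit b)
                                                           (Equivalence.to ∉⇔lookup i∉S) ⟩
    + count (λ j → N₂ j ∧ s j) ℤ.+ + 0             ≡⟨ ℤ.+-identityʳ _ ⟩
    + count (λ j → N₂ j ∧ s j)                     ∎
    where open ≡-Reasoning

  c-row-inside : i ∈ S → ∑ℤ (λ j → c G i j ℤ.* indicator S j) ≡ + count (λ j → N₂ j ∧ s j) ℤ.- + 1
  c-row-inside i∈S = trans c-row (cong (λ b → + count (λ j → N₂ j ∧ s j) ℤ.- + bit b)
                                       (Equivalence.to ∈⇔lookup i∈S))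

  c-constraint⇔restrained : ∑ℤ (λ j → c G i j ℤ.* indicator S j) ℤ.< + deg2 G i
                          ⇔ (i ∉ S → ∃[ v ] v ∉ S × Dist2 G i v)
  c-constraint⇔restrained = mk⇔ to from
    where
    N₂∩S⊆N₂ : (λ j → N₂ j ∧ s j) ⊆ᵇ N₂
    N₂∩S⊆N₂ j h = proj₁ (∧≡true⇒ h)
    to : ∑ℤ (λ j → c G i j ℤ.* indicator S j) ℤ.< + deg2 G i → i ∉ S → ∃[ v ] v ∉ S × Dist2 G i v
    to row i∉S
      with (v , v∉N₂∩S , d) ← Equivalence.to (count-<⇔∃ N₂∩S⊆N₂)
                                (ℤ.drop‿+<+ (subst (ℤ._< + deg2 G i) (c-row-outside i∉S) row))
      = v , Equivalence.from ∉⇔lookup (subst (λ b → b ∧ s v ≡ false) d v∉N₂∩S) , d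
    from : (i ∉ S → ∃[ v ] v ∉ S × Dist2 G i v) → ∑ℤ (λ j → c G i j ℤ.* indicator S j) ℤ.< + deg2 G i
    from restrained with i ∈? S
    ... | yes i∈S = subst (ℤ._< + deg2 G i) (≡-sym (c-row-inside i∈S))
                      (ℤ.<-≤-trans (ℤ.m⊖1+n<m (count (λ j → N₂ j ∧ s j)) 1) (+≤+ (count-mono N₂∩S⊆N₂)))
    ... | no  i∉S with (v , v∉S , d) ← restrained i∉S
      = subst (ℤ._< + deg2 G i) (≡-sym (c-row-outside i∉S))
          (+<+ (Equivalence.from (count-<⇔∃ N₂∩S⊆N₂)
                  (v , trans (cong (_∧ s v) d) (Equivalence.to ∉⇔lookup v∉S) , d)))

module _ {n : ℕ} (G : Graph n) where

  indicator-feasible⇔ : (S : Subset n) → Feasible G (indicator S) ⇔ Is2StepRestrainedDominating G S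
  indicator-feasible⇔ S = mk⇔
    (λ (_ , a-ok , c-ok) → (λ u → Equivalence.to (a-constraint⇔hop G S u) (a-ok u))
                         , (λ u → Equivalence.to (c-constraint⇔restrained G S u) (c-ok u)))
    (λ (hop , restrained) → indicator-binary S
                          , (λ i → Equivalence.from (a-constraint⇔hop G S i) (hop i))
                          , (λ i → Equivalence.from (c-constraint⇔restrained G S i) (restrained i)))

  Feasible-resp-≗ : {x y : Fin n → ℤ} → (∀ j → x j ≡ y j) → Feasible G x → Feasible G y
  Feasible-resp-≗ {x} {y} x≗y (x-binary , a-ok , c-ok) =
      (λ j → subst (λ z → z ≡ + 0 ⊎ z ≡ + 1) (x≗y j) (x-binary j))
    , (λ i → subst (+ 1 ℤ.≤_) (∑ℤ-cong (λ j → cong (a G i j ℤ.*_) (x≗y j))) (a-ok i))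
    , (λ i → subst (ℤ._< + deg2 G i) (∑ℤ-cong (λ j → cong (c G i j ℤ.*_) (x≗y j))) (c-ok i))

  feasible⇒2srd-support : {x : Fin n → ℤ} → Feasible G x →
                          Is2StepRestrainedDominating G (support x) × ∑ℤ x ≡ + ∣ support x ∣
  feasible⇒2srd-support {x} x-feasible@(x-binary , _) =
      Equivalence.to (indicator-feasible⇔ (support x)) (Feasible-resp-≗ x≗indicator x-feasible)
    , trans (∑ℤ-cong x≗indicator) (∑-indicator (support x))
    where
    x≗indicator : ∀ j → x j ≡ indicator (support x) j
    x≗indicator = binary⇒indicator-support x-binary

  2srd? : (S : Subset n) → Dec (Is2StepRestrainedDominating G S)
  2srd? S = all? (λ u → ¬? (u ∈? S) →-dec any? (λ v → (v ∈? S) ×-dec dist2? u v))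
     ×-dec all? (λ u → ¬? (u ∈? S) →-dec any? (λ v → ¬? (v ∈? S) ×-dec dist2? u v))
    where
    dist2? : ∀ u v → Dec (Dist2 G u v)
    dist2? u v = dist2 G u v Bool.≟ true

  ⊤-2srd : Is2StepRestrainedDominating G ⊤
  ⊤-2srd = (λ u u∉⊤ → contradiction ∈⊤ u∉⊤) , (λ u u∉⊤ → contradiction ∈⊤ u∉⊤)

  2srd-of-size? : ∀ k → Dec (∃[ S ] Is2StepRestrainedDominating G S × ∣ S ∣ ≡ k)
  2srd-of-size? k = anySubset? (λ S → 2srd? S ×-dec (∣ S ∣ ℕ.≟ k))

  gamma2sr-exists : ∃[ k ] IsGamma2sr G k
  gamma2sr-exists
    with (k , smallest , minimal) ← least-witness 2srd-of-size? (⊤ , ⊤-2srd , refl)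
    = k , smallest , (λ S S-2srd → minimal (S , S-2srd , refl))

  gamma2sr⇒optimalValue : ∀ {k} → IsGamma2sr G k → IsOptimalValue G (+ k)
  gamma2sr⇒optimalValue {k} ((S , S-2srd , ∣S∣≡k) , minimal) = optimum , lower-bound
    where
    optimum : ∃[ x ] Feasible G x × ∑ℤ x ≡ + k
    optimum = indicator S , Equivalence.from (indicator-feasible⇔ S) S-2srd
            , trans (∑-indicator S) (cong +_ ∣S∣≡k)
    lower-bound : ∀ x → Feasible G x → + k ℤ.≤ ∑ℤ x
    lower-bound x x-feasible with (support-2srd , ∑x≡∣support∣) ← feasible⇒2srd-support x-feasible
      = subst (+ k ℤ.≤_) (≡-sym ∑x≡∣support∣) (+≤+ (minimal (support x) support-2srd))

mainTheorem5 : (n : ℕ) (G : Graph n) → Σ ℕ (λ k → IsOptimalValue G (+ k) × IsGamma2sr G k)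
mainTheorem5 n G with (k , γ₂sr) ← gamma2sr-exists G = k , gamma2sr⇒optimalValue G γ₂sr , γ₂sr
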